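{- Let $n\ge 2$, let $G_n\in HL_n$, and let $g$ be an integer with $1\le g\le 2^{n-2}$. Then $(n-2)g-2e_g\ge 0$, where $e_g$ is the maximum number of edges of a subgraph of $G_n$ induced by $g$ vertices.
   Context: HL-networks are defined recursively: $HL_0=\{K_1\}$ and $HL_n=\{G_{n-1}\oplus G^*_{n-1} : G_{n-1},G^*_{n-1}\in HL_{n-1}\}$, where $G_{n-1}\oplus G^*_{n-1}$ denotes any graph obtained from the disjoint union of $G_{n-1}$ and $G^*_{n-1}$ by adding a perfect matching between their vertex sets. Each $G_n\in HL_n$ is $n$-regular with $2^n$ vertices. -}

module Defs where

open import Data.Nat using (ℕ; zero; suc; _+_; _*_; _≤_; ⌊_/2⌋)
open import Data.Bool using (Bool; true; false; _∧_)
open import Data.Unit using (⊤; tt)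
open import Data.Sum using (_⊎_; inj₁; inj₂)
open import Data.Product using (Σ; _×_; _,_)
open import Relation.Binary.PropositionalEquality using (_≡_)

Vtx : ℕ → Set
Vtx zero    = ⊤
Vtx (suc n) = Vtx n ⊎ Vtx n

eqV : ∀ {n} → Vtx n → Vtx n → Bool
eqV {zero}  _ _ = true
eqV {suc n} (inj₁ a) (inj₁ b) = eqV a b
eqV {suc n} (inj₂ a) (inj₂ b) = eqV a b
eqV {suc n} (inj₁ _) (inj₂ _) = false
eqV {suc n} (inj₂ _) (inj₁ _) = false

-- A perfect matching between two copies of Vtx n, given as a bijection
-- π (vertex a of the first copy is matched with π a of the second copy).
record Matching (n : ℕ) : Set where
  field
    π     : Vtx n → Vtx n
    π⁻¹   : Vtx n → Vtx n
    left  : ∀ a → π⁻¹ (π a) ≡ a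
    right : ∀ b → π (π⁻¹ b) ≡ b

-- HL n : the constructions of HL-networks G_n ∈ HL_n.
-- K1 is the single-vertex graph; G ⊕[ M ] G* is the disjoint union of
-- G and G* plus the perfect matching M between their vertex sets.
data HL : ℕ → Set where
  K1     : HL zero
  _⊕[_]_ : ∀ {n} → HL n → Matching n → HL n → HL (suc n)

adj : ∀ {n} → HL n → Vtx n → Vtx n → Bool
adj K1 _ _ = false
adj (G ⊕[ M ] H) (inj₁ a) (inj₁ b) = adj G a b
adj (G ⊕[ M ] H) (inj₂ a) (inj₂ b) = adj H a b
adj (G ⊕[ M ] H) (inj₁ a) (inj₂ b) = eqV (Matching.π M a) b
adj (G ⊕[ M ] H) (inj₂ b) (inj₁ a) = eqV (Matching.π M a) b

count : ∀ {n} → (Vtx n → Bool) → ℕ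
count {zero}  f = if' (f tt)
  where
    if' : Bool → ℕ
    if' true  = 1
    if' false = 0
count {suc n} f = count (λ v → f (inj₁ v)) + count (λ v → f (inj₂ v))

Subset : ℕ → Set
Subset n = Vtx n → Bool

size : ∀ {n} → Subset n → ℕ
size S = count S

-- Number of edges of the subgraph of G induced by S: the number of
-- ordered adjacent pairs (u , v) with u , v ∈ S, halved (the graph is
-- simple and undirected, so every edge is counted exactly twice).
sumV : ∀ {n} → (Vtx n → ℕ) → ℕ
sumV {zero}  f = f tt
sumV {suc n} f = sumV (λ v → f (inj₁ v)) + sumV (λ v → f (inj₂ v))

inducedEdges : ∀ {n} → HL n → Subset n → ℕ
inducedEdges G S =
  ⌊ sumV (λ u → count (λ v → S u ∧ S v ∧ adj G u v)) /2⌋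

IsMaxInducedEdges : ∀ {n} → HL n → ℕ → ℕ → Set
IsMaxInducedEdges G g e =
  Σ (Subset _) (λ S → size S ≡ g × inducedEdges G S ≡ e)
  × (∀ (S : Subset _) → size S ≡ g → inducedEdges G S ≤ e)

-- Let h n = h ⌊n/2⌋ + h ⌈n/2⌉ + ⌊n/2⌋ (the largest number of edges spanned by n vertices of a
-- hypercube). A vertex set S of G ⊕ G* splits into S₁ ⊆ G and S₂ ⊆ G*, and the perfect matching
-- adds at most min(|S₁|, |S₂|) edges between them; the superadditivity
-- h a + h b + min(a, b) ≤ h (a + b) therefore gives, by induction, that S spans at most h |S|
-- edges. Halving g repeatedly then shows 2 h g ≤ k g whenever g ≤ 2^k.
module Submission where

open import Data.Bool using (Bool; true; false; _∧_)
open import Data.Bool.Properties using (∧-assoc; ∧-comm; ∧-conicalˡ; ∧-conicalʳ)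
open import Data.Integer using (+_; _-_; +≤+) renaming (_*_ to _*ℤ_; _≤_ to _≤ℤ_)
import Data.Integer.Properties as ℤ
open import Data.Nat
open import Data.Nat.Properties
open import Data.Nat.Tactic.RingSolver using (solve-∀)
open import Data.Product using (_×_; _,_; proj₁; proj₂)
open import Data.Sum using (inj₁; inj₂)
open import Function using (_∘_; flip)
open import Relation.Binary.PropositionalEquality
open import Relation.Nullary using (yes; no)

open import Defs

open ≤-Reasoning

hᶠ : ℕ → ℕ → ℕ
hᶠ zero    _                = 0
hᶠ (suc f) zero             = 0
hᶠ (suc f) (suc zero)       = 0
hᶠ (suc f) n@(suc (suc _)) = hᶠ f ⌊ n /2⌋ + hᶠ f ⌈ n /2⌉ + ⌊ n /2⌋

hᶠ-fuel-irrelevant : ∀ f f′ n → n < f → n < f′ → hᶠ f n ≡ hᶠ f′ n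
hᶠ-fuel-irrelevant (suc f) (suc f′) zero       _ _ = refl
hᶠ-fuel-irrelevant (suc f) (suc f′) (suc zero) _ _ = refl
hᶠ-fuel-irrelevant (suc f) (suc f′) n@(suc (suc m)) (s≤s n≤f) (s≤s n≤f′) =
  cong₂ (λ x y → x + y + ⌊ n /2⌋)
    (hᶠ-fuel-irrelevant f f′ ⌊ n /2⌋ (⌊n/2⌋<f n≤f) (⌊n/2⌋<f n≤f′))
    (hᶠ-fuel-irrelevant f f′ ⌈ n /2⌉ (<-≤-trans (⌈n/2⌉<n m) n≤f) (<-≤-trans (⌈n/2⌉<n m) n≤f′))
  where
  ⌊n/2⌋<f : ∀ {fuel} → n ≤ fuel → ⌊ n /2⌋ < fuel
  ⌊n/2⌋<f n≤f = ≤-<-trans (⌊n/2⌋≤⌈n/2⌉ n) (<-≤-trans (⌈n/2⌉<n m) n≤f)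

h : ℕ → ℕ
h n = hᶠ (suc n) n

h-halves : ∀ n → h n ≡ h ⌊ n /2⌋ + h ⌈ n /2⌉ + ⌊ n /2⌋
h-halves zero       = refl
h-halves (suc zero) = refl
h-halves n@(suc (suc m)) =
  cong₂ (λ x y → x + y + ⌊ n /2⌋)
    (hᶠ-fuel-irrelevant (suc (suc m)) (suc ⌊ n /2⌋) ⌊ n /2⌋
       (≤-<-trans (⌊n/2⌋≤⌈n/2⌉ n) (⌈n/2⌉<n m)) ≤-refl)
    (hᶠ-fuel-irrelevant (suc (suc m)) (suc ⌈ n /2⌉) ⌈ n /2⌉ (⌈n/2⌉<n m) ≤-refl)

h-double : ∀ p → h (p + p) ≡ h p + h p + p
h-double p rewrite h-halves (p + p) | sym (n≡⌊n+n/2⌋ p) | sym (n≡⌈n+n/2⌉ p) = refl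

h-suc-double : ∀ p → h (suc (p + p)) ≡ h p + h (suc p) + p
h-suc-double p rewrite h-halves (suc (p + p)) | sym (n≡⌊n+n/2⌋ p) | sym (n≡⌈n+n/2⌉ p) = refl

data EvenOdd : ℕ → Set where
  even : ∀ p → EvenOdd (p + p)
  odd  : ∀ p → EvenOdd (suc (p + p))

evenOdd : ∀ n → EvenOdd n
evenOdd zero = even 0
evenOdd (suc n) with evenOdd n
... | even p = odd p
... | odd p  = subst EvenOdd (cong suc (+-suc p p)) (even (suc p))

2^suc≡2^+2^ : ∀ k → 2 ^ suc k ≡ 2 ^ k + 2 ^ k
2^suc≡2^+2^ k = cong (λ m → 2 ^ k + m) (+-identityʳ (2 ^ k))

n<2^n : ∀ n → n < 2 ^ n
n<2^n zero    = s≤s z≤n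
n<2^n (suc n) = subst (suc (suc n) ≤_) (sym (2^suc≡2^+2^ n)) (+-mono-≤ (m^n>0 2 n) (n<2^n n))

⌈n/2⌉≤2^ : ∀ k {n} → n ≤ 2 ^ suc k → ⌈ n /2⌉ ≤ 2 ^ k
⌈n/2⌉≤2^ k {n} n≤ =
  subst (⌈ n /2⌉ ≤_) (sym (n≡⌈n+n/2⌉ (2 ^ k))) (⌈n/2⌉-mono (subst (n ≤_) (2^suc≡2^+2^ k) n≤))

double≤2^suc⇒≤2^ : ∀ k p → p + p ≤ 2 ^ suc k → p ≤ 2 ^ k
double≤2^suc⇒≤2^ k p le = subst (_≤ 2 ^ k) (sym (n≡⌈n+n/2⌉ p)) (⌈n/2⌉≤2^ k le)

sucDouble≤2^suc⇒<2^ : ∀ k p → suc (p + p) ≤ 2 ^ suc k → p < 2 ^ k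
sucDouble≤2^suc⇒<2^ k p le = subst (_≤ 2 ^ k) (cong suc (sym (n≡⌊n+n/2⌋ p))) (⌈n/2⌉≤2^ k le)

2*⌊n/2⌋≤n : ∀ n → 2 * ⌊ n /2⌋ ≤ n
2*⌊n/2⌋≤n n = begin
  2 * ⌊ n /2⌋         ≡⟨ cong (λ m → ⌊ n /2⌋ + m) (+-identityʳ ⌊ n /2⌋) ⟩
  ⌊ n /2⌋ + ⌊ n /2⌋   ≤⟨ +-monoʳ-≤ ⌊ n /2⌋ (⌊n/2⌋≤⌈n/2⌉ n) ⟩
  ⌊ n /2⌋ + ⌈ n /2⌉   ≡⟨ ⌊n/2⌋+⌈n/2⌉≡n n ⟩
  n                   ∎

Superadditive : ℕ → ℕ → Set
Superadditive a b = h a + h b + a ⊓ b ≤ h (a + b)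

superadditive-comm : ∀ a b → Superadditive a b → Superadditive b a
superadditive-comm a b =
  subst₂ _≤_ (cong₂ _+_ (+-comm (h a) (h b)) (⊓-comm a b)) (cong h (+-comm a b))

double-⊓ : ∀ p q → (p + p) ⊓ (q + q) ≡ p ⊓ q + p ⊓ q
double-⊓ p q = sym (mono-≤-distrib-⊓ {λ x → x + x} (λ le → +-mono-≤ le le) p q)

double-⊓-sucDouble : ∀ p q → (p + p) ⊓ suc (q + q) ≤ p ⊓ q + p ⊓ suc q
double-⊓-sucDouble p q with p ≤? q
... | yes p≤q rewrite m≤n⇒m⊓n≡m p≤q | m≤n⇒m⊓n≡m (m≤n⇒m≤1+n p≤q) = m⊓n≤m (p + p) _
... | no p≰q  rewrite m≥n⇒m⊓n≡n (<⇒≤ (≰⇒> p≰q)) | m≥n⇒m⊓n≡n (≰⇒> p≰q) =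
  ≤-trans (m⊓n≤n (p + p) _) (≤-reflexive (sym (+-suc q q)))

sucDouble-⊓ : ∀ p q → suc (p + p) ⊓ suc (q + q) ≤ suc (p ⊓ suc q + suc p ⊓ q)
sucDouble-⊓ p q = s≤s (begin
  (p + p) ⊓ (q + q)       ≡⟨ double-⊓ p q ⟩
  p ⊓ q + p ⊓ q           ≤⟨ +-mono-≤ (⊓-monoʳ-≤ p (n≤1+n q)) (⊓-monoˡ-≤ q (n≤1+n p)) ⟩
  p ⊓ suc q + suc p ⊓ q   ∎)

superadditive-double : ∀ p q → Superadditive p q → Superadditive (p + p) (q + q)
superadditive-double p q sup = begin
  h (p + p) + h (q + q) + (p + p) ⊓ (q + q)
    ≡⟨ cong₂ _+_ (cong₂ _+_ (h-double p) (h-double q)) (double-⊓ p q) ⟩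
  (h p + h p + p) + (h q + h q + q) + (p ⊓ q + p ⊓ q)
    ≡⟨ shuffle (h p) (h q) p q (p ⊓ q) ⟩
  (h p + h q + p ⊓ q) + (h p + h q + p ⊓ q) + (p + q)
    ≤⟨ +-monoˡ-≤ (p + q) (+-mono-≤ sup sup) ⟩
  h (p + q) + h (p + q) + (p + q)
    ≡⟨ sym (h-double (p + q)) ⟩
  h ((p + q) + (p + q))
    ≡⟨ cong h (interchange p q) ⟩
  h ((p + p) + (q + q)) ∎
  where
  shuffle : ∀ x y p q m → (x + x + p) + (y + y + q) + (m + m) ≡ (x + y + m) + (x + y + m) + (p + q)
  shuffle = solve-∀
  interchange : ∀ p q → (p + q) + (p + q) ≡ (p + p) + (q + q)
  interchange = solve-∀

superadditive-double-sucDouble : ∀ p q → Superadditive p q → Superadditive p (suc q) →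
  Superadditive (p + p) (suc (q + q))
superadditive-double-sucDouble p q sup sup′ = begin
  h (p + p) + h (suc (q + q)) + (p + p) ⊓ suc (q + q)
    ≤⟨ +-mono-≤ (≤-reflexive (cong₂ _+_ (h-double p) (h-suc-double q))) (double-⊓-sucDouble p q) ⟩
  (h p + h p + p) + (h q + h (suc q) + q) + (p ⊓ q + p ⊓ suc q)
    ≡⟨ shuffle (h p) (h q) (h (suc q)) p q (p ⊓ q) (p ⊓ suc q) ⟩
  (h p + h q + p ⊓ q) + (h p + h (suc q) + p ⊓ suc q) + (p + q)
    ≤⟨ +-monoˡ-≤ (p + q) (+-mono-≤ sup sup′) ⟩
  h (p + q) + h (p + suc q) + (p + q)
    ≡⟨ cong (λ m → h (p + q) + h m + (p + q)) (+-suc p q) ⟩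
  h (p + q) + h (suc (p + q)) + (p + q)
    ≡⟨ sym (h-suc-double (p + q)) ⟩
  h (suc ((p + q) + (p + q)))
    ≡⟨ cong h (interchange p q) ⟩
  h ((p + p) + suc (q + q)) ∎
  where
  shuffle : ∀ x y y′ p q m m′ → (x + x + p) + (y + y′ + q) + (m + m′)
                               ≡ (x + y + m) + (x + y′ + m′) + (p + q)
  shuffle = solve-∀
  interchange : ∀ p q → suc ((p + q) + (p + q)) ≡ (p + p) + suc (q + q)
  interchange = solve-∀

superadditive-sucDouble : ∀ p q → Superadditive p (suc q) → Superadditive (suc p) q →
  Superadditive (suc (p + p)) (suc (q + q))
superadditive-sucDouble p q sup sup′ = begin
  h (suc (p + p)) + h (suc (q + q)) + suc (p + p) ⊓ suc (q + q)
    ≤⟨ +-mono-≤ (≤-reflexive (cong₂ _+_ (h-suc-double p) (h-suc-double q))) (sucDouble-⊓ p q) ⟩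
  (h p + h (suc p) + p) + (h q + h (suc q) + q) + suc (p ⊓ suc q + suc p ⊓ q)
    ≡⟨ shuffle (h p) (h (suc p)) (h q) (h (suc q)) p q (p ⊓ suc q) (suc p ⊓ q) ⟩
  (h p + h (suc q) + p ⊓ suc q) + (h (suc p) + h q + suc p ⊓ q) + suc (p + q)
    ≤⟨ +-monoˡ-≤ (suc (p + q)) (+-mono-≤ sup sup′) ⟩
  h (p + suc q) + h (suc (p + q)) + suc (p + q)
    ≡⟨ cong (λ m → h m + h (suc (p + q)) + suc (p + q)) (+-suc p q) ⟩
  h (suc (p + q)) + h (suc (p + q)) + suc (p + q)
    ≡⟨ sym (h-double (suc (p + q))) ⟩
  h (suc (p + q) + suc (p + q))
    ≡⟨ cong h (interchange p q) ⟩
  h (suc (p + p) + suc (q + q)) ∎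
  where
  shuffle : ∀ x x′ y y′ p q m m′ → (x + x′ + p) + (y + y′ + q) + suc (m + m′)
                                  ≡ (x + y′ + m) + (x′ + y + m′) + suc (p + q)
  shuffle = solve-∀
  interchange : ∀ p q → suc (p + q) + suc (p + q) ≡ suc (p + p) + suc (q + q)
  interchange = solve-∀

h-superadditive-≤2^ : ∀ k a b → a ≤ 2 ^ k → b ≤ 2 ^ k → Superadditive a b
h-superadditive-≤2^ zero .0 .0 z≤n       z≤n       = z≤n
h-superadditive-≤2^ zero .0 .1 z≤n       (s≤s z≤n) = z≤n
h-superadditive-≤2^ zero .1 .0 (s≤s z≤n) z≤n       = z≤n
h-superadditive-≤2^ zero .1 .1 (s≤s z≤n) (s≤s z≤n) = s≤s z≤n
h-superadditive-≤2^ (suc k) a b a≤ b≤ with evenOdd a | evenOdd b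
... | even p | even q =
  superadditive-double p q (IH p q (double≤2^suc⇒≤2^ k p a≤) (double≤2^suc⇒≤2^ k q b≤))
  where IH = h-superadditive-≤2^ k
... | even p | odd q =
  superadditive-double-sucDouble p q (IH p q p≤ (<⇒≤ q<)) (IH p (suc q) p≤ q<)
  where IH = h-superadditive-≤2^ k
        p≤ = double≤2^suc⇒≤2^ k p a≤
        q< = sucDouble≤2^suc⇒<2^ k q b≤
... | odd p | even q = superadditive-comm (q + q) (suc (p + p))
  (superadditive-double-sucDouble q p (IH q p q≤ (<⇒≤ p<)) (IH q (suc p) q≤ p<))
  where IH = h-superadditive-≤2^ k
        p< = sucDouble≤2^suc⇒<2^ k p a≤
        q≤ = double≤2^suc⇒≤2^ k q b≤
... | odd p | odd q =
  superadditive-sucDouble p q (IH p (suc q) (<⇒≤ p<) q<) (IH (suc p) q p< (<⇒≤ q<))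
  where IH = h-superadditive-≤2^ k
        p< = sucDouble≤2^suc⇒<2^ k p a≤
        q< = sucDouble≤2^suc⇒<2^ k q b≤

h-superadditive : ∀ a b → Superadditive a b
h-superadditive a b = h-superadditive-≤2^ (a + b) a b
  (≤-trans (m≤m+n a b) (<⇒≤ (n<2^n (a + b))))
  (≤-trans (m≤n+m b a) (<⇒≤ (n<2^n (a + b))))

2*h≤k* : ∀ k n → n ≤ 2 ^ k → 2 * h n ≤ k * n
2*h≤k* zero    .0 z≤n       = z≤n
2*h≤k* zero    .1 (s≤s z≤n) = z≤n
2*h≤k* (suc k) n  n≤ = begin
  2 * h n
    ≡⟨ cong (2 *_) (h-halves n) ⟩
  2 * (h ⌊ n /2⌋ + h ⌈ n /2⌉ + ⌊ n /2⌋)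
    ≡⟨ distribute (h ⌊ n /2⌋) (h ⌈ n /2⌉) ⌊ n /2⌋ ⟩
  2 * h ⌊ n /2⌋ + 2 * h ⌈ n /2⌉ + 2 * ⌊ n /2⌋
    ≤⟨ +-mono-≤ (+-mono-≤ (2*h≤k* k ⌊ n /2⌋ (≤-trans (⌊n/2⌋≤⌈n/2⌉ n) ⌈n/2⌉≤))
                          (2*h≤k* k ⌈ n /2⌉ ⌈n/2⌉≤))
                (2*⌊n/2⌋≤n n) ⟩
  k * ⌊ n /2⌋ + k * ⌈ n /2⌉ + n
    ≡⟨ cong (_+ n) (sym (*-distribˡ-+ k ⌊ n /2⌋ ⌈ n /2⌉)) ⟩
  k * (⌊ n /2⌋ + ⌈ n /2⌉) + n
    ≡⟨ cong (λ m → k * m + n) (⌊n/2⌋+⌈n/2⌉≡n n) ⟩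
  k * n + n
    ≡⟨ +-comm (k * n) n ⟩
  suc k * n ∎
  where
  ⌈n/2⌉≤ = ⌈n/2⌉≤2^ k n≤
  distribute : ∀ x y z → 2 * (x + y + z) ≡ 2 * x + 2 * y + 2 * z
  distribute = solve-∀

indicator : Bool → ℕ
indicator true  = 1
indicator false = 0

count≡sumV-indicator : ∀ {n} (f : Vtx n → Bool) → count f ≡ sumV (indicator ∘ f)
count≡sumV-indicator {zero}  f with f _
... | true  = refl
... | false = refl
count≡sumV-indicator {suc n} f =
  cong₂ _+_ (count≡sumV-indicator (f ∘ inj₁)) (count≡sumV-indicator (f ∘ inj₂))

count-cong : ∀ {n} {f g : Vtx n → Bool} → (∀ v → f v ≡ g v) → count f ≡ count g
count-cong {zero}  f≡g rewrite f≡g _ = refl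
count-cong {suc n} f≡g = cong₂ _+_ (count-cong (f≡g ∘ inj₁)) (count-cong (f≡g ∘ inj₂))

count-mono : ∀ {n} (f g : Vtx n → Bool) → (∀ v → f v ≡ true → g v ≡ true) → count f ≤ count g
count-mono {zero}  f g f⇒g with f _ | g _ | f⇒g _
... | false | _     | _ = z≤n
... | true  | true  | _ = ≤-refl
... | true  | false | t⇒f with t⇒f refl
...   | ()
count-mono {suc n} f g f⇒g =
  +-mono-≤ (count-mono _ _ (f⇒g ∘ inj₁)) (count-mono _ _ (f⇒g ∘ inj₂))

count-false : ∀ {n} → count {n} (λ _ → false) ≡ 0
count-false {zero}  = refl
count-false {suc n} = cong₂ _+_ (count-false {n}) (count-false {n})

eqV-refl : ∀ {n} (a : Vtx n) → eqV a a ≡ true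
eqV-refl {zero}  _        = refl
eqV-refl {suc n} (inj₁ a) = eqV-refl a
eqV-refl {suc n} (inj₂ a) = eqV-refl a

eqV-sound : ∀ {n} (a b : Vtx n) → eqV a b ≡ true → a ≡ b
eqV-sound {zero}  _        _        _  = refl
eqV-sound {suc n} (inj₁ a) (inj₁ b) eq = cong inj₁ (eqV-sound a b eq)
eqV-sound {suc n} (inj₂ a) (inj₂ b) eq = cong inj₂ (eqV-sound a b eq)

count-eqV : ∀ {n} (c : Vtx n) → count (eqV c) ≡ 1
count-eqV {zero}  _        = refl
count-eqV {suc n} (inj₁ c) = cong₂ _+_ (count-eqV c) (count-false {n})
count-eqV {suc n} (inj₂ c) = cong₂ _+_ (count-false {n}) (count-eqV c)

count-≤-indicator : ∀ {n} (x : Bool) (c : Vtx n) (f : Vtx n → Bool) →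
  (∀ v → f v ≡ true → x ≡ true × v ≡ c) → count f ≤ indicator x
count-≤-indicator {n} false c f f⇒ = begin
  count f                   ≤⟨ count-mono f (λ _ → false) (λ v → proj₁ ∘ f⇒ v) ⟩
  count {n} (λ _ → false)   ≡⟨ count-false {n} ⟩
  0                         ∎
count-≤-indicator true c f f⇒ = begin
  count f         ≤⟨ count-mono f (eqV c) f⇒eqV ⟩
  count (eqV c)   ≡⟨ count-eqV c ⟩
  1               ∎
  where
  f⇒eqV : ∀ v → f v ≡ true → eqV c v ≡ true
  f⇒eqV v fv = subst (λ w → eqV c w ≡ true) (sym (proj₂ (f⇒ v fv))) (eqV-refl c)

sumV-cong : ∀ {n} {f g : Vtx n → ℕ} → (∀ v → f v ≡ g v) → sumV f ≡ sumV g
sumV-cong {zero}  f≡g = f≡g _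
sumV-cong {suc n} f≡g = cong₂ _+_ (sumV-cong (f≡g ∘ inj₁)) (sumV-cong (f≡g ∘ inj₂))

sumV-mono : ∀ {n} {f g : Vtx n → ℕ} → (∀ v → f v ≤ g v) → sumV f ≤ sumV g
sumV-mono {zero}  f≤g = f≤g _
sumV-mono {suc n} f≤g = +-mono-≤ (sumV-mono (f≤g ∘ inj₁)) (sumV-mono (f≤g ∘ inj₂))

sumV-+ : ∀ {n} (f g : Vtx n → ℕ) → sumV (λ v → f v + g v) ≡ sumV f + sumV g
sumV-+ {zero}  f g = refl
sumV-+ {suc n} f g = begin-equality
  sumV (λ v → f (inj₁ v) + g (inj₁ v)) + sumV (λ v → f (inj₂ v) + g (inj₂ v))
    ≡⟨ cong₂ _+_ (sumV-+ (f ∘ inj₁) (g ∘ inj₁)) (sumV-+ (f ∘ inj₂) (g ∘ inj₂)) ⟩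
  (sumV (f ∘ inj₁) + sumV (g ∘ inj₁)) + (sumV (f ∘ inj₂) + sumV (g ∘ inj₂))
    ≡⟨ +-comm-middle (sumV (f ∘ inj₁)) (sumV (g ∘ inj₁)) (sumV (f ∘ inj₂)) (sumV (g ∘ inj₂)) ⟩
  (sumV (f ∘ inj₁) + sumV (f ∘ inj₂)) + (sumV (g ∘ inj₁) + sumV (g ∘ inj₂)) ∎
  where
  +-comm-middle : ∀ a b c d → (a + b) + (c + d) ≡ (a + c) + (b + d)
  +-comm-middle = solve-∀

sumV-swap : ∀ {n m} (F : Vtx n → Vtx m → ℕ) →
  sumV (λ a → sumV (F a)) ≡ sumV (λ b → sumV (λ a → F a b))
sumV-swap {zero}  F = refl
sumV-swap {suc n} F = begin-equality
  sumV (λ a → sumV (F (inj₁ a))) + sumV (λ a → sumV (F (inj₂ a)))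
    ≡⟨ cong₂ _+_ (sumV-swap (F ∘ inj₁)) (sumV-swap (F ∘ inj₂)) ⟩
  sumV (λ b → sumV (λ a → F (inj₁ a) b)) + sumV (λ b → sumV (λ a → F (inj₂ a) b))
    ≡⟨ sym (sumV-+ (λ b → sumV (λ a → F (inj₁ a) b)) (λ b → sumV (λ a → F (inj₂ a) b))) ⟩
  sumV (λ b → sumV (λ a → F (inj₁ a) b) + sumV (λ a → F (inj₂ a) b)) ∎

pairs : ∀ {n m} → (Vtx n → Vtx m → Bool) → ℕ
pairs R = sumV (λ a → count (R a))

pairs-cong : ∀ {n m} {R R′ : Vtx n → Vtx m → Bool} → (∀ a b → R a b ≡ R′ a b) → pairs R ≡ pairs R′
pairs-cong R≡R′ = sumV-cong (λ a → count-cong (R≡R′ a))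

pairs-swap : ∀ {n m} (R : Vtx n → Vtx m → Bool) → pairs R ≡ pairs (flip R)
pairs-swap R = begin-equality
  sumV (λ a → count (R a))
    ≡⟨ sumV-cong (λ a → count≡sumV-indicator (R a)) ⟩
  sumV (λ a → sumV (λ b → indicator (R a b)))
    ≡⟨ sumV-swap (λ a b → indicator (R a b)) ⟩
  sumV (λ b → sumV (λ a → indicator (R a b)))
    ≡⟨ sumV-cong (λ b → sym (count≡sumV-indicator (flip R b))) ⟩
  sumV (λ b → count (flip R b)) ∎

pairs-≤-count : ∀ {n} (R : Vtx n → Vtx n → Bool) (P : Subset n) (f : Vtx n → Vtx n) →
  (∀ a b → R a b ≡ true → P a ≡ true × b ≡ f a) → pairs R ≤ count P
pairs-≤-count R P f R⇒ = begin
  pairs R                        ≤⟨ sumV-mono (λ a → count-≤-indicator (P a) (f a) (R a) (R⇒ a)) ⟩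
  sumV (indicator ∘ P)           ≡⟨ sym (count≡sumV-indicator P) ⟩
  count P                        ∎

matched : ∀ {n} → Matching n → Subset n → Subset n → Vtx n → Vtx n → Bool
matched M P Q a b = P a ∧ Q b ∧ eqV (Matching.π M a) b

matched-≤ˡ : ∀ {n} (M : Matching n) (P Q : Subset n) → pairs (matched M P Q) ≤ count P
matched-≤ˡ M P Q = pairs-≤-count (matched M P Q) P (Matching.π M) λ a b m →
  ∧-conicalˡ (P a) _ m ,
  sym (eqV-sound _ _ (∧-conicalʳ (Q b) _ (∧-conicalʳ (P a) _ m)))

matched-≤ʳ : ∀ {n} (M : Matching n) (P Q : Subset n) → pairs (matched M P Q) ≤ count Q
matched-≤ʳ M P Q = begin
  pairs (matched M P Q)          ≡⟨ pairs-swap (matched M P Q) ⟩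
  pairs (flip (matched M P Q))   ≤⟨ pairs-≤-count _ Q π⁻¹ flipped⇒ ⟩
  count Q                        ∎
  where
  open Matching M
  flipped⇒ : ∀ b a → matched M P Q a b ≡ true → Q b ≡ true × a ≡ π⁻¹ b
  flipped⇒ b a m = ∧-conicalˡ (Q b) _ (∧-conicalʳ (P a) _ m) ,
    trans (sym (left a)) (cong π⁻¹ (eqV-sound _ _ (∧-conicalʳ (Q b) _ (∧-conicalʳ (P a) _ m))))

degreeSum : ∀ {n} → HL n → Subset n → ℕ
degreeSum G S = pairs (λ u v → S u ∧ S v ∧ adj G u v)

degreeSum-⊕ : ∀ {n} (G H : HL n) (M : Matching n) (S : Subset (suc n)) →
  degreeSum (G ⊕[ M ] H) S ≡
    degreeSum G (S ∘ inj₁) + pairs (matched M (S ∘ inj₁) (S ∘ inj₂))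
    + (pairs (matched M (S ∘ inj₁) (S ∘ inj₂)) + degreeSum H (S ∘ inj₂))
degreeSum-⊕ G H M S = cong₂ _+_
  (sumV-+ (λ a → count (λ b → S₁ a ∧ S₁ b ∧ adj G a b)) (λ a → count (matched M S₁ S₂ a)))
  (trans (sumV-+ (λ b → count (λ a → S₂ b ∧ S₁ a ∧ eqV (Matching.π M a) b))
                 (λ b → count (λ c → S₂ b ∧ S₂ c ∧ adj H b c)))
         (cong (_+ degreeSum H S₂) second-half))
  where
  S₁ S₂ : Subset _
  S₁ = S ∘ inj₁
  S₂ = S ∘ inj₂
  reorder : ∀ x y z → y ∧ x ∧ z ≡ x ∧ y ∧ z
  reorder x y z = trans (sym (∧-assoc y x z)) (trans (cong (_∧ z) (∧-comm y x)) (∧-assoc x y z))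
  second-half : pairs (λ b a → S₂ b ∧ S₁ a ∧ eqV (Matching.π M a) b) ≡ pairs (matched M S₁ S₂)
  second-half = trans (pairs-cong (λ b a → reorder (S₁ a) (S₂ b) _))
                      (sym (pairs-swap (matched M S₁ S₂)))

degreeSum-≤ : ∀ {n} (G : HL n) (S : Subset n) → degreeSum G S ≤ 2 * h (size S)
degreeSum-≤ K1 S with S _
... | true  = z≤n
... | false = z≤n
degreeSum-≤ (G ⊕[ M ] H) S = begin
  degreeSum (G ⊕[ M ] H) S
    ≡⟨ degreeSum-⊕ G H M S ⟩
  degreeSum G S₁ + c + (c + degreeSum H S₂)
    ≤⟨ +-mono-≤ (+-mono-≤ (degreeSum-≤ G S₁) c≤) (+-mono-≤ c≤ (degreeSum-≤ H S₂)) ⟩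
  2 * h a + a ⊓ b + (a ⊓ b + 2 * h b)
    ≡⟨ collect (h a) (h b) (a ⊓ b) ⟩
  2 * (h a + h b + a ⊓ b)
    ≤⟨ *-monoʳ-≤ 2 (h-superadditive a b) ⟩
  2 * h (a + b) ∎
  where
  S₁ S₂ : Subset _
  S₁ = S ∘ inj₁
  S₂ = S ∘ inj₂
  a = size S₁
  b = size S₂
  c = pairs (matched M S₁ S₂)
  c≤ : c ≤ a ⊓ b
  c≤ = ⊓-glb (matched-≤ˡ M S₁ S₂) (matched-≤ʳ M S₁ S₂)
  collect : ∀ x y m → 2 * x + m + (m + 2 * y) ≡ 2 * (x + y + m)
  collect = solve-∀

lemma2p3 : (n : ℕ) → 2 ≤ n → (G : HL n) → (g : ℕ) → 1 ≤ g → g ≤ 2 ^ (n ∸ 2) →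
    (e : ℕ) → IsMaxInducedEdges G g e →
    + 0 ≤ℤ (+ (n ∸ 2) *ℤ + g) - (+ 2 *ℤ + e)
lemma2p3 n _ G g _ g≤ e ((S , |S|≡g , edges≡e) , _) =
  subst₂ (λ x y → + 0 ≤ℤ x - y) (ℤ.pos-* (n ∸ 2) g) (ℤ.pos-* 2 e) (ℤ.i≤j⇒0≤j-i (+≤+ 2e≤))
  where
  2e≤ : 2 * e ≤ (n ∸ 2) * g
  2e≤ = begin
    2 * e                       ≡⟨ cong (2 *_) (sym edges≡e) ⟩
    2 * ⌊ degreeSum G S /2⌋     ≤⟨ 2*⌊n/2⌋≤n (degreeSum G S) ⟩
    degreeSum G S               ≤⟨ degreeSum-≤ G S ⟩
    2 * h (size S)              ≡⟨ cong (λ m → 2 * h m) |S|≡g ⟩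
    2 * h g                     ≤⟨ 2*h≤k* (n ∸ 2) g g≤ ⟩
    (n ∸ 2) * g                 ∎
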